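{- Let $n$ be a composite integer which is not the square of a prime, and let $\mathcal{M}$ be the set of all edges of $\Upsilon_n$ of the form $\{x,n/x\}$ with $x$ a proper divisor of $n$ and $x<\sqrt{n}$. Then $\mathcal{M}$ is a matching in $\Upsilon_n$ of maximum size, and the matching number satisfies $\alpha'(\Upsilon_n)=|\mathcal{M}|=\lfloor\pi(n)/2\rfloor$.
   Context: For an integer $n>1$, a proper divisor of $n$ is an integer $d$ with $1<d<n$ and $d\mid n$; $\pi(n)$ denotes the number of proper divisors of $n$. The proper divisor graph $\Upsilon_n$ is the simple graph whose vertices are the proper divisors of $n$, two distinct vertices $u,v$ being adjacent iff $n\mid uv$. -}

module Defs where

open import Data.Nat using (ℕ; zero; suc; _*_; _<_; _<?_; _/_)
open import Data.Nat.Divisibility using (_∣_; _∣?_)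
open import Data.Product using (_×_; _,_; proj₁; proj₂)
open import Data.List using (List; []; _∷_; filter; map; upTo; length; concatMap)
open import Data.List.Relation.Unary.All using (All)
open import Data.List.Relation.Unary.Unique.Propositional using (Unique)
open import Relation.Nullary using (¬_)
open import Relation.Nullary.Decidable using (_×-dec_)
open import Relation.Binary.PropositionalEquality using (_≡_)

ProperDivisor : ℕ → ℕ → Set
ProperDivisor n d = 1 < d × d < n × d ∣ n

properDivisors : ℕ → List ℕ
properDivisors n = filter (λ d → (1 <? d) ×-dec ((d <? n) ×-dec (d ∣? n))) (upTo n)

π : ℕ → ℕ
π n = length (properDivisors n)

-- adjacency in the proper divisor graph Υ_n (edges as ordered pairs
-- representing the unordered edge {u , v})
IsEdge : ℕ → ℕ × ℕ → Set
IsEdge n (u , v) = ProperDivisor n u × ProperDivisor n v × ¬ (u ≡ v) × n ∣ u * v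

endpoints : List (ℕ × ℕ) → List ℕ
endpoints = concatMap (λ e → proj₁ e ∷ proj₂ e ∷ [])

-- a matching in Υ_n: a list of edges of Υ_n, no two sharing a vertex
-- (all endpoints pairwise distinct; this also forces the edges to be distinct)
IsMatching : ℕ → List (ℕ × ℕ) → Set
IsMatching n M = All (IsEdge n) M × Unique (endpoints M)

-- n / x, with a dummy value for x = 0 (never used: x is a proper divisor)
quot : ℕ → ℕ → ℕ
quot n zero = zero
quot n (suc k) = n / suc k

𝓜 : ℕ → List (ℕ × ℕ)
𝓜 n = map (λ x → x , quot n x) (filter (λ x → x * x <? n) (properDivisors n))

module Submission where

-- The map x ↦ n / x is an involution of the proper divisors of n exchanging those below √n
-- with those above it, so π(n) = r + 2s, where s counts the proper divisors below √n and
-- r ≤ 1 counts square roots of n. The s edges {x , n / x} with x < √n are pairwise disjoint,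
-- and a matching N covers 2|N| distinct vertices, so |N| ≤ ⌊ π(n) / 2 ⌋ = s.

open import Defs
open import Data.Nat using (ℕ; suc; _+_; _*_; _≤_; _<_; ⌊_/2⌋; _<?_; _≟_; z≤n; s≤s; NonZero; >-nonZero)
open import Data.Nat.Properties
open import Data.Nat.Divisibility using (_∣_; _∣?_; ∣-refl; quotient>1; quotient-<; quotient-∣; n/m≡quotient)
open import Data.Nat.DivMod using (m*[n/m]≡n)
open import Data.Nat.Primality using (Prime; Composite)
open import Data.Product using (Σ; _×_; _,_; proj₁; proj₂)
open import Data.List using (List; []; _∷_; length; filter; map; upTo)
open import Data.List.Properties using (length-map; filter-notAll; filter-accept; filter-reject)
open import Data.List.Relation.Unary.All as All using (All; []; _∷_)
import Data.List.Relation.Unary.All.Properties as All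
open import Data.List.Relation.Unary.Any as Any using (here; there)
open import Data.List.Relation.Unary.AllPairs using ([]; _∷_)
open import Data.List.Relation.Unary.Unique.Propositional using (Unique)
import Data.List.Relation.Unary.Unique.Propositional.Properties as Unique
open import Data.List.Membership.Propositional using (_∈_)
open import Data.List.Membership.Propositional.Properties using (∈-filter⁺; ∈-filter⁻; ∈-upTo⁺; ∈-map⁻)
open import Data.List.Relation.Binary.Subset.Propositional using (_⊆_)
open import Function using (_∘_)
open import Relation.Nullary using (¬_; ¬?; contradiction)
open import Relation.Nullary.Decidable using (_×-dec_)
open import Relation.Unary using (Decidable)
open import Relation.Binary.Definitions using (DecidableEquality; tri<; tri≈; tri>)
open import Relation.Binary.PropositionalEquality using (_≡_; _≢_; refl; sym; trans; cong; subst; module ≡-Reasoning)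

InjectiveOn : {A B : Set} → (A → B) → List A → Set
InjectiveOn f xs = ∀ {x y} → x ∈ xs → y ∈ xs → f x ≡ f y → x ≡ y

Unique-map⁺ : {A B : Set} {f : A → B} {xs : List A} →
              InjectiveOn f xs → Unique xs → Unique (map f xs)
Unique-map⁺ {xs = []}    _   []            = []
Unique-map⁺ {xs = x ∷ _} inj (x∉xs ∷ xs!) =
  All.map⁺ (All.tabulate λ y∈ fx≡fy → All.lookup x∉xs y∈ (inj (here refl) (there y∈) fx≡fy))
  ∷ Unique-map⁺ (λ x∈ y∈ → inj (there x∈) (there y∈)) xs!

module _ {A : Set} (_≟ᴬ_ : DecidableEquality A) where

  Unique⇒length≤ : {xs ys : List A} → Unique xs → xs ⊆ ys → length xs ≤ length ys
  Unique⇒length≤ {[]}     _            _     = z≤n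
  Unique⇒length≤ {x ∷ xs} {ys} (x∉xs ∷ xs!) xs⊆ys = begin
    suc (length xs)                  ≤⟨ s≤s (Unique⇒length≤ xs! xs⊆ys-x) ⟩
    suc (length (filter x≢? ys))     ≤⟨ filter-notAll x≢? ys (Any.map (λ x≡y x≢y → x≢y x≡y) (xs⊆ys (here refl))) ⟩
    length ys                        ∎
    where
    open ≤-Reasoning
    x≢? = λ y → ¬? (x ≟ᴬ y)
    xs⊆ys-x : xs ⊆ filter x≢? ys
    xs⊆ys-x y∈ = ∈-filter⁺ x≢? (xs⊆ys (there y∈)) (All.lookup x∉xs y∈)

  InjectiveOn⇒length≤ : {f : A → A} {xs ys : List A} → Unique xs → InjectiveOn f xs →
                        (∀ {x} → x ∈ xs → f x ∈ ys) → length xs ≤ length ys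
  InjectiveOn⇒length≤ {f} {xs} {ys} xs! inj maps-into = begin
    length xs         ≡⟨ sym (length-map f xs) ⟩
    length (map f xs) ≤⟨ Unique⇒length≤ (Unique-map⁺ inj xs!) image⊆ys ⟩
    length ys         ∎
    where
    open ≤-Reasoning
    image⊆ys : map f xs ⊆ ys
    image⊆ys y∈ with ∈-map⁻ f y∈
    ... | _ , x∈ , refl = maps-into x∈

module _ {A : Set} (f : A → ℕ) (m : ℕ) where

  count< count≡ count> : List A → ℕ
  count< xs = length (filter (λ x → f x <? m) xs)
  count≡ xs = length (filter (λ x → f x ≟ m) xs)
  count> xs = length (filter (λ x → m <? f x) xs)

  length-trichotomy : (xs : List A) → length xs ≡ count≡ xs + (count< xs + count> xs)
  length-trichotomy [] = refl
  length-trichotomy (x ∷ xs) with ih ← length-trichotomy xs | <-cmp (f x) m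
  ... | tri< fx<m fx≢m fx≯m
    rewrite filter-reject (λ x → f x ≟ m) {x} {xs} fx≢m | filter-accept (λ x → f x <? m) {x} {xs} fx<m
          | filter-reject (λ x → m <? f x) {x} {xs} fx≯m
    = trans (cong suc ih) (sym (+-suc (count≡ xs) (count< xs + count> xs)))
  ... | tri≈ fx≮m fx≡m fx≯m
    rewrite filter-accept (λ x → f x ≟ m) {x} {xs} fx≡m | filter-reject (λ x → f x <? m) {x} {xs} fx≮m
          | filter-reject (λ x → m <? f x) {x} {xs} fx≯m
    = cong suc ih
  ... | tri> fx≮m fx≢m fx>m
    rewrite filter-reject (λ x → f x ≟ m) {x} {xs} fx≢m | filter-reject (λ x → f x <? m) {x} {xs} fx≮m
          | filter-accept (λ x → m <? f x) {x} {xs} fx>m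
    = trans (cong suc ih) (sym (trans (cong (count≡ xs +_) (+-suc (count< xs) (count> xs)))
                                      (+-suc (count≡ xs) (count< xs + count> xs))))

graph : (ℕ → ℕ) → List ℕ → List (ℕ × ℕ)
graph f = map (λ x → x , f x)

All-endpoints⁺ : {P : ℕ → Set} {N : List (ℕ × ℕ)} →
                 All (λ e → P (proj₁ e) × P (proj₂ e)) N → All P (endpoints N)
All-endpoints⁺ []                = []
All-endpoints⁺ ((pu , pv) ∷ pN) = pu ∷ pv ∷ All-endpoints⁺ pN

All-endpoints-graph : {P : ℕ → Set} {f : ℕ → ℕ} {xs : List ℕ} →
                      (∀ {x} → x ∈ xs → P x × P (f x)) → All P (endpoints (graph f xs))
All-endpoints-graph h = All-endpoints⁺ (All.map⁺ (All.tabulate h))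

Unique-endpoints-graph : {f : ℕ → ℕ} {xs : List ℕ} → Unique xs → InjectiveOn f xs →
                         (∀ {x y} → x ∈ xs → y ∈ xs → x ≢ f y) → Unique (endpoints (graph f xs))
Unique-endpoints-graph {xs = []}    _             _   _ = []
Unique-endpoints-graph {xs = x ∷ _} (x∉xs ∷ xs!) inj x≢f =
  (x≢f (here refl) (here refl) ∷ All-endpoints-graph (λ y∈ → All.lookup x∉xs y∈ , x≢f (here refl) (there y∈)))
  ∷ All-endpoints-graph (λ y∈ → (λ fx≡y → x≢f (there y∈) (here refl) (sym fx≡y))
                               , (λ fx≡fy → All.lookup x∉xs y∈ (inj (here refl) (there y∈) fx≡fy)))
  ∷ Unique-endpoints-graph xs! (λ x∈ y∈ → inj (there x∈) (there y∈)) (λ x∈ y∈ → x≢f (there x∈) (there y∈))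

length-endpoints : (N : List (ℕ × ℕ)) → length (endpoints N) ≡ length N + length N
length-endpoints []      = refl
length-endpoints (_ ∷ N) = cong suc (trans (cong suc (length-endpoints N)) (sym (+-suc _ _)))

small⇒large : ∀ {x y n} → x * y ≡ n → x * x < n → n < y * y
small⇒large {x} {y} {n} xy≡n xx<n = begin-strict
  n     ≡⟨ sym xy≡n ⟩
  x * y <⟨ *-monoˡ-< y {{>-nonZero (≤-<-trans z≤n x<y)}} x<y ⟩
  y * y ∎
  where
  open ≤-Reasoning
  x<y : x < y
  x<y = *-cancelˡ-< x x y (subst (x * x <_) (sym xy≡n) xx<n)

large⇒small : ∀ {x y n} .{{_ : NonZero y}} → x * y ≡ n → n < x * x → y * y < n
large⇒small {x} {y} {n} xy≡n n<xx = begin-strict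
  y * y <⟨ *-monoˡ-< y y<x ⟩
  x * y ≡⟨ xy≡n ⟩
  n     ∎
  where
  open ≤-Reasoning
  y<x : y < x
  y<x = *-cancelˡ-< x y x (subst (_< x * x) (sym xy≡n) n<xx)

square-injective : ∀ {a b} → a * a ≡ b * b → a ≡ b
square-injective {a} {b} aa≡bb with <-cmp a b
... | tri< a<b _ _   = contradiction aa≡bb (<⇒≢ (*-mono-< a<b a<b))
... | tri≈ _ a≡b _   = a≡b
... | tri> _ _ b<a   = contradiction (sym aa≡bb) (<⇒≢ (*-mono-< b<a b<a))

length-square-roots≤1 : ∀ {n} {xs : List ℕ} → Unique xs → All (λ x → x * x ≡ n) xs → length xs ≤ 1
length-square-roots≤1 {xs = []}        _                 _                 = z≤n
length-square-roots≤1 {xs = _ ∷ []}    _                 _                 = s≤s z≤n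
length-square-roots≤1 {xs = _ ∷ _ ∷ _} ((x≢y ∷ _) ∷ _) (xx≡n ∷ yy≡n ∷ _) =
  contradiction (square-injective (trans xx≡n (sym yy≡n))) x≢y

⌊e+[s+s]/2⌋≡s : ∀ {e} s → e ≤ 1 → ⌊ e + (s + s) /2⌋ ≡ s
⌊e+[s+s]/2⌋≡s s z≤n       = sym (n≡⌊n+n/2⌋ s)
⌊e+[s+s]/2⌋≡s s (s≤s z≤n) = sym (n≡⌈n+n/2⌉ s)

module ProperDivisorGraph (n : ℕ) where

  properDivisor? : Decidable (ProperDivisor n)
  properDivisor? d = (1 <? d) ×-dec ((d <? n) ×-dec (d ∣? n))

  ∈-properDivisors⁺ : ∀ {d} → ProperDivisor n d → d ∈ properDivisors n
  ∈-properDivisors⁺ d-pd@(_ , d<n , _) = ∈-filter⁺ properDivisor? (∈-upTo⁺ d<n) d-pd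

  ∈-properDivisors⁻ : ∀ {d} → d ∈ properDivisors n → ProperDivisor n d
  ∈-properDivisors⁻ = proj₂ ∘ ∈-filter⁻ properDivisor? {xs = upTo n}

  properDivisors-unique : Unique (properDivisors n)
  properDivisors-unique = Unique.filter⁺ properDivisor? (Unique.upTo⁺ n)

  quot-cofactor : ∀ {x} → ProperDivisor n x → x * quot n x ≡ n
  quot-cofactor {suc _} (_ , _ , x∣n) = m*[n/m]≡n x∣n

  ProperDivisor-quot : ∀ {x} → ProperDivisor n x → ProperDivisor n (quot n x)
  ProperDivisor-quot {suc (suc _)} (s≤s (s≤s z≤n) , x<n@(s≤s _) , x∣n)
    = subst (ProperDivisor n) (sym (n/m≡quotient x∣n)) (quotient>1 x∣n x<n , quotient-< x∣n , quotient-∣ x∣n)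

  quot-nonZero : ∀ {x} → ProperDivisor n x → NonZero (quot n x)
  quot-nonZero x-pd = >-nonZero (<-trans (s≤s z≤n) (proj₁ (ProperDivisor-quot x-pd)))

  quot-injective : ∀ {x y} → ProperDivisor n x → ProperDivisor n y → quot n x ≡ quot n y → x ≡ y
  quot-injective {x} {y} x-pd y-pd qx≡qy = *-cancelʳ-≡ x y (quot n x) {{quot-nonZero x-pd}} (begin
    x * quot n x ≡⟨ quot-cofactor x-pd ⟩
    n            ≡⟨ sym (quot-cofactor y-pd) ⟩
    y * quot n y ≡⟨ cong (y *_) (sym qx≡qy) ⟩
    y * quot n x ∎)
    where open ≡-Reasoning

  square : ℕ → ℕ
  square x = x * x

  small? : Decidable (λ x → square x < n)
  small? x = square x <? n

  root? : Decidable (λ x → square x ≡ n)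
  root? x = square x ≟ n

  large? : Decidable (λ x → n < square x)
  large? x = n <? square x

  small roots large : List ℕ
  small = filter small? (properDivisors n)
  roots = filter root? (properDivisors n)
  large = filter large? (properDivisors n)

  ∈-small⁻ : ∀ {x} → x ∈ small → ProperDivisor n x × x * x < n
  ∈-small⁻ x∈ with ∈-filter⁻ small? {xs = properDivisors n} x∈
  ... | x∈D , xx<n = ∈-properDivisors⁻ x∈D , xx<n

  ∈-large⁻ : ∀ {x} → x ∈ large → ProperDivisor n x × n < x * x
  ∈-large⁻ x∈ with ∈-filter⁻ large? {xs = properDivisors n} x∈
  ... | x∈D , n<xx = ∈-properDivisors⁻ x∈D , n<xx

  small-unique : Unique small
  small-unique = Unique.filter⁺ small? properDivisors-unique

  large-unique : Unique large
  large-unique = Unique.filter⁺ large? properDivisors-unique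

  quot-injectiveOn-small : InjectiveOn (quot n) small
  quot-injectiveOn-small x∈ y∈ = quot-injective (proj₁ (∈-small⁻ x∈)) (proj₁ (∈-small⁻ y∈))

  quot-injectiveOn-large : InjectiveOn (quot n) large
  quot-injectiveOn-large x∈ y∈ = quot-injective (proj₁ (∈-large⁻ x∈)) (proj₁ (∈-large⁻ y∈))

  quot-small∈large : ∀ {x} → x ∈ small → quot n x ∈ large
  quot-small∈large {x} x∈ with ∈-small⁻ x∈
  ... | x-pd , xx<n = ∈-filter⁺ large? (∈-properDivisors⁺ (ProperDivisor-quot x-pd))
                                (small⇒large {x} (quot-cofactor x-pd) xx<n)

  quot-large∈small : ∀ {x} → x ∈ large → quot n x ∈ small
  quot-large∈small {x} x∈ with ∈-large⁻ x∈
  ... | x-pd , n<xx = ∈-filter⁺ small? (∈-properDivisors⁺ (ProperDivisor-quot x-pd))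
                                (large⇒small {x} {{quot-nonZero x-pd}} (quot-cofactor x-pd) n<xx)

  |small|≡|large| : length small ≡ length large
  |small|≡|large| = ≤-antisym
    (InjectiveOn⇒length≤ _≟_ small-unique quot-injectiveOn-small quot-small∈large)
    (InjectiveOn⇒length≤ _≟_ large-unique quot-injectiveOn-large quot-large∈small)

  |roots|≤1 : length roots ≤ 1
  |roots|≤1 = length-square-roots≤1 (Unique.filter⁺ root? properDivisors-unique)
    (All.tabulate (proj₂ ∘ ∈-filter⁻ root? {xs = properDivisors n}))

  π≡|roots|+2|small| : π n ≡ length roots + (length small + length small)
  π≡|roots|+2|small| = begin
    π n                                           ≡⟨ length-trichotomy square n (properDivisors n) ⟩
    length roots + (length small + length large) ≡⟨ cong (λ k → length roots + (length small + k)) (sym |small|≡|large|) ⟩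
    length roots + (length small + length small) ∎
    where open ≡-Reasoning

  quot-separates-small : ∀ {x y} → x ∈ small → y ∈ small → x ≢ quot n y
  quot-separates-small {y = y} x∈ y∈ refl with ∈-small⁻ y∈
  ... | y-pd , yy<n = <-asym (proj₂ (∈-small⁻ x∈)) (small⇒large {y} (quot-cofactor y-pd) yy<n)

  𝓜-isMatching : IsMatching n (𝓜 n)
  𝓜-isMatching = All.map⁺ (All.tabulate edge)
               , Unique-endpoints-graph small-unique quot-injectiveOn-small quot-separates-small
    where
    edge : ∀ {x} → x ∈ small → IsEdge n (x , quot n x)
    edge x∈ with ∈-small⁻ x∈
    ... | x-pd , _ = x-pd , ProperDivisor-quot x-pd , quot-separates-small x∈ x∈
                   , subst (n ∣_) (sym (quot-cofactor x-pd)) ∣-refl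

  matching-covers : ∀ {N} → IsMatching n N → length N + length N ≤ π n
  matching-covers {N} (edges , endpoints-unique) =
    subst (_≤ π n) (length-endpoints N) (Unique⇒length≤ _≟_ endpoints-unique (All.lookup endpoints⊆D))
    where
    endpoints⊆D : All (_∈ properDivisors n) (endpoints N)
    endpoints⊆D = All-endpoints⁺ (All.map (λ (u-pd , v-pd , _) → ∈-properDivisors⁺ u-pd , ∈-properDivisors⁺ v-pd) edges)

  length-𝓜 : length (𝓜 n) ≡ ⌊ π n /2⌋
  length-𝓜 = begin
    length (𝓜 n)                                        ≡⟨ length-map _ small ⟩
    length small                                        ≡⟨ sym (⌊e+[s+s]/2⌋≡s (length small) |roots|≤1) ⟩
    ⌊ length roots + (length small + length small) /2⌋ ≡⟨ cong ⌊_/2⌋ (sym π≡|roots|+2|small|) ⟩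
    ⌊ π n /2⌋                                           ∎
    where open ≡-Reasoning

  𝓜-maximum : (N : List (ℕ × ℕ)) → IsMatching n N → length N ≤ length (𝓜 n)
  𝓜-maximum N N-matching = begin
    length N                  ≡⟨ n≡⌊n+n/2⌋ (length N) ⟩
    ⌊ length N + length N /2⌋ ≤⟨ ⌊n/2⌋-mono (matching-covers N-matching) ⟩
    ⌊ π n /2⌋                 ≡⟨ sym length-𝓜 ⟩
    length (𝓜 n)              ∎
    where open ≤-Reasoning

proposition5p4 : (n : ℕ) → Composite n → ¬ (Σ ℕ (λ p → Prime p × n ≡ p * p)) →
      IsMatching n (𝓜 n)
    × ((N : List (ℕ × ℕ)) → IsMatching n N → length N ≤ length (𝓜 n))
    × length (𝓜 n) ≡ ⌊ π n /2⌋
proposition5p4 n _ _ = 𝓜-isMatching , 𝓜-maximum , length-𝓜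
  where open ProperDivisorGraph n
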